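{- For every $k \geq 2$ and every $n \geq 3$, the DCell graph $D_{k,n}$ is not vertex-transitive.
   Context: DCell graphs $D_{k,n}$ ($k \geq 0$, $n \geq 2$) are defined recursively. $D_{0,n}$ is the complete graph $K_n$ on vertices labeled $0,1,\dots,n-1$. Let $t_{k,n}$ denote the number of vertices of $D_{k,n}$. For $k \geq 1$, $D_{k,n}$ consists of $t_{k-1,n}+1$ disjoint copies $D^i_{k-1,n}$, $i = 0,1,\dots,t_{k-1,n}$, of $D_{k-1,n}$; a vertex of $D^i_{k-1,n}$ is labeled $(i,a_{k-1},\dots,a_0)$, where $(a_{k-1},\dots,a_0)$ is its label in $D_{k-1,n}$. For a suffix $(a_j,\dots,a_0)$ define $uid_j = a_0 + \sum_{l=1}^{j} a_l\, t_{l-1,n}$. Besides the edges inside the copies, for every pair $a<b$ of copy indices there is exactly one additional edge, joining the vertex of $D^a_{k-1,n}$ whose suffix has $uid_{k-1} = b-1$ to the vertex of $D^b_{k-1,n}$ whose suffix has $uid_{k-1} = a$. A graph is vertex-transitive if its automorphism group acts transitively on its vertices. -}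

module Defs where

open import Data.Nat using (ℕ; zero; suc; _+_; _*_; _∸_; _<_)
open import Data.Fin using (Fin; toℕ)
open import Data.Product using (Σ; _×_; _,_)
open import Data.Sum using (_⊎_)
open import Relation.Binary.PropositionalEquality using (_≡_; _≢_)
open import Function.Bundles using (_↔_; Inverse)
open import Function.Bundles using (_⇔_)

-- t k n = number of vertices of D_{k,n}
t : ℕ → ℕ → ℕ
t zero    n = n
t (suc k) n = (t k n + 1) * t k n

-- Vertices of D_{k,n}: labels (a_k, ..., a_0).
-- D_{0,n} has vertices 0..n-1; a vertex of D_{k+1,n} is (i , label in D_{k,n})
-- with copy index i ∈ {0, ..., t_{k,n}}.
V : ℕ → ℕ → Set
V zero    n = Fin n
V (suc k) n = Fin (t k n + 1) × V k n

uid : (k n : ℕ) → V k n → ℕ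
uid zero    n a       = toℕ a
uid (suc k) n (a , x) = toℕ a * t k n + uid k n x

Cross : (k n : ℕ) → Fin (t k n + 1) → V k n → Fin (t k n + 1) → V k n → Set
Cross k n a x b y = (toℕ a < toℕ b) × (uid k n x ≡ toℕ b ∸ 1) × (uid k n y ≡ toℕ a)

Adj : (k n : ℕ) → V k n → V k n → Set
Adj zero    n x y = x ≢ y
Adj (suc k) n (i , x) (j , y) =
  ((i ≡ j) × Adj k n x y) ⊎ (Cross k n i x j y ⊎ Cross k n j y i x)

IsAutomorphism : {V : Set} → (V → V → Set) → V ↔ V → Set
IsAutomorphism {V} E σ = ∀ (x y : V) → E x y ⇔ E (Inverse.to σ x) (Inverse.to σ y)

VertexTransitive : (V : Set) → (V → V → Set) → Set
VertexTransitive V E =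
  ∀ (u v : V) → Σ (V ↔ V) (λ σ → IsAutomorphism E σ × (Inverse.to σ u ≡ v))

module Submission where

-- For n ≥ 3 an edge of D_{k,n} lies on a triangle exactly when it is an edge of a bottom copy
-- of K_n; the other edges join two copies. Every non-triangle edge at the vertex 0…0 lies on a
-- hexagon whose edges alternate between triangle and non-triangle edges, running through the
-- copies 0, 1, 2 of the level at which the edge lives. The vertex (0,1,0,…,0) of D_{k,n}, k ≥ 2,
-- is joined to copy t_{k-2,n} + 1, and this edge lies on no such hexagon: the hexagon would pass
-- through a third copy, where its triangle edge would join a vertex of uid ≥ t_{k-2,n} to one of
-- uid 0, whereas the ends of a triangle edge have uids differing by less than n. Automorphisms
-- preserve triangles and hence this property, so none maps one of these vertices to the other.

open import Defs
open import Data.Nat using (ℕ; zero; suc; _+_; _*_; _∸_; _≤_; _<_; z≤n; s≤s; >-nonZero)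
open import Data.Nat.Properties hiding (_≟_)
open import Data.Fin using (Fin; toℕ; fromℕ<; combine; inject≤; _≟_)
  renaming (zero to 0F; suc to sucF)
open import Data.Fin.Properties using (toℕ-injective; toℕ<n; toℕ-fromℕ<; toℕ-combine; combine-injective; toℕ-inject≤)
open import Data.Product using (Σ; _×_; _,_; proj₁)
open import Data.Sum using (_⊎_; inj₁; inj₂; swap)
open import Data.Empty using (⊥-elim)
open import Function.Bundles using (_↔_; _⇔_; Inverse; Equivalence)
open import Function.Construct.Symmetry using (⇔-sym; ↔-sym)
open import Relation.Binary.PropositionalEquality
open import Relation.Nullary using (¬_; yes; no)

separated⇒¬vertexTransitive : {V : Set} {E : V → V → Set} (P : V → Set) →
  (∀ σ → IsAutomorphism E σ → ∀ {v} → P v → P (Inverse.to σ v)) →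
  ∀ {u v} → P u → ¬ P v → ¬ VertexTransitive V E
separated⇒¬vertexTransitive P invariant {u} {v} pu ¬pv vt with vt u v
... | σ , aut , refl = ¬pv (invariant σ aut pu)

module Graph {V : Set} (E : V → V → Set) where

  CommonNeighbour : V → V → Set
  CommonNeighbour x y = Σ V λ z → E x z × E y z

  TriangleEdge : V → V → Set
  TriangleEdge x y = E x y × CommonNeighbour x y

  NonTriangleEdge : V → V → Set
  NonTriangleEdge x y = E x y × ¬ CommonNeighbour x y

  -- Together with a non-triangle edge v w, such a path closes a hexagon
  -- whose edges alternate between triangle and non-triangle edges.
  AlternatingPath : V → V → Set
  AlternatingPath w v = Σ V λ w₂ → Σ V λ w₃ → Σ V λ w₄ → Σ V λ w₅ →
    TriangleEdge w w₂ × NonTriangleEdge w₂ w₃ × TriangleEdge w₃ w₄ ×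
    NonTriangleEdge w₄ w₅ × TriangleEdge w₅ v

  HasNonHexagonalEdge : V → Set
  HasNonHexagonalEdge v = Σ V λ w → NonTriangleEdge v w × ¬ AlternatingPath w v

  Invariant : (V → V → Set) → Set
  Invariant R = ∀ σ → IsAutomorphism E σ → ∀ {x y} → R x y → R (Inverse.to σ x) (Inverse.to σ y)

  automorphism-inverse : ∀ σ → IsAutomorphism E σ → IsAutomorphism E (↔-sym σ)
  automorphism-inverse σ aut x y =
    subst₂ (λ a b → E a b ⇔ E (from x) (from y))
      (Inverse.strictlyInverseˡ σ x) (Inverse.strictlyInverseˡ σ y)
      (⇔-sym (aut (from x) (from y)))
    where open Inverse σ using (from)

  invariant-reflect : ∀ {R} → Invariant R → ∀ σ → IsAutomorphism E σ →
    ∀ {x y} → R (Inverse.to σ x) (Inverse.to σ y) → R x y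
  invariant-reflect {R} inv σ aut {x} {y} r =
    subst₂ R (Inverse.strictlyInverseʳ σ x) (Inverse.strictlyInverseʳ σ y)
      (inv (↔-sym σ) (automorphism-inverse σ aut) r)

  E-invariant : Invariant E
  E-invariant σ aut {x} {y} = Equivalence.to (aut x y)

  CommonNeighbour-invariant : Invariant CommonNeighbour
  CommonNeighbour-invariant σ aut (z , xz , yz) =
    Inverse.to σ z , E-invariant σ aut xz , E-invariant σ aut yz

  TriangleEdge-invariant : Invariant TriangleEdge
  TriangleEdge-invariant σ aut (e , c) = E-invariant σ aut e , CommonNeighbour-invariant σ aut c

  NonTriangleEdge-invariant : Invariant NonTriangleEdge
  NonTriangleEdge-invariant σ aut (e , ¬c) =
    E-invariant σ aut e , λ c → ¬c (invariant-reflect CommonNeighbour-invariant σ aut c)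

  AlternatingPath-invariant : Invariant AlternatingPath
  AlternatingPath-invariant σ aut (w₂ , w₃ , w₄ , w₅ , t₁ , n₁ , t₂ , n₂ , t₃) =
    f w₂ , f w₃ , f w₄ , f w₅ ,
    TriangleEdge-invariant σ aut t₁ , NonTriangleEdge-invariant σ aut n₁ ,
    TriangleEdge-invariant σ aut t₂ , NonTriangleEdge-invariant σ aut n₂ ,
    TriangleEdge-invariant σ aut t₃
    where f = Inverse.to σ

  HasNonHexagonalEdge-invariant : ∀ σ → IsAutomorphism E σ →
    ∀ {v} → HasNonHexagonalEdge v → HasNonHexagonalEdge (Inverse.to σ v)
  HasNonHexagonalEdge-invariant σ aut (w , vw , ¬path) =
    Inverse.to σ w , NonTriangleEdge-invariant σ aut vw ,
    λ path → ¬path (invariant-reflect AlternatingPath-invariant σ aut path)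

module DCell (n : ℕ) where

  module D (k : ℕ) = Graph (Adj k n)

  -- uid as a mixed-radix numeral in Fin (t k n), which makes it a bijection.
  label : ∀ k → V k n → Fin (t k n)
  label zero    x       = x
  label (suc k) (a , x) = combine a (label k x)

  toℕ-label : ∀ k x → toℕ (label k x) ≡ uid k n x
  toℕ-label zero    x       = refl
  toℕ-label (suc k) (a , x) = begin
    toℕ (combine a (label k x))          ≡⟨ toℕ-combine a (label k x) ⟩
    t k n * toℕ a + toℕ (label k x)      ≡⟨ cong₂ _+_ (*-comm (t k n) (toℕ a)) (toℕ-label k x) ⟩
    toℕ a * t k n + uid k n x            ∎
    where open ≡-Reasoning

  label-injective : ∀ k {x y} → label k x ≡ label k y → x ≡ y
  label-injective zero    eq = eq
  label-injective (suc k) {a , x} {b , y} eq with combine-injective a (label k x) b (label k y) eq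
  ... | refl , eq′ = cong (a ,_) (label-injective k eq′)

  uid-injective : ∀ k {x y} → uid k n x ≡ uid k n y → x ≡ y
  uid-injective k {x} {y} eq =
    label-injective k (toℕ-injective (trans (toℕ-label k x) (trans eq (sym (toℕ-label k y)))))

  n≤t : ∀ k → n ≤ t k n
  n≤t zero    = ≤-refl
  n≤t (suc k) = ≤-trans (n≤t k) (m≤n*m (t k n) (t k n + 1) {{>-nonZero (m≤n+m 1 (t k n))}})

  Adj-irrefl : ∀ k {x} → ¬ Adj k n x x
  Adj-irrefl zero    x≢x                      = x≢x refl
  Adj-irrefl (suc k) (inj₁ (_ , xx))           = Adj-irrefl k xx
  Adj-irrefl (suc k) (inj₂ (inj₁ (i<i , _))) = <-irrefl refl i<i
  Adj-irrefl (suc k) (inj₂ (inj₂ (i<i , _))) = <-irrefl refl i<i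

  Bridge : ∀ k → Fin (t k n + 1) → V k n → Fin (t k n + 1) → V k n → Set
  Bridge k i x j y = Cross k n i x j y ⊎ Cross k n j y i x

  bridge-copies-distinct : ∀ k {i j x y} → Bridge k i x j y → i ≢ j
  bridge-copies-distinct k (inj₁ (i<j , _)) refl = <-irrefl refl i<j
  bridge-copies-distinct k (inj₂ (j<i , _)) refl = <-irrefl refl j<i

  bridge-uid-≤ : ∀ k {i j x y} → Bridge k i x j y → uid k n x ≤ toℕ j
  bridge-uid-≤ k (inj₁ (_ , ux , _)) = ≤-trans (≤-reflexive ux) (m∸n≤m _ 1)
  bridge-uid-≤ k (inj₂ (_ , _ , ux)) = ≤-reflexive ux

  bridge-uid-≥ : ∀ k {i j x y} → Bridge k i x j y → toℕ j ∸ 1 ≤ uid k n x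
  bridge-uid-≥ k (inj₁ (_ , ux , _)) = ≤-reflexive (sym ux)
  bridge-uid-≥ k (inj₂ (_ , _ , ux)) = ≤-trans (m∸n≤m _ 1) (≤-reflexive (sym ux))

  bridge-source-unique : ∀ k {i j x x′ y y′} → Bridge k i x j y → Bridge k i x′ j y′ → x ≡ x′
  bridge-source-unique k {x = x} {x′} b b′ = uid-injective k (uid-unique b b′)
    where
      uid-unique : ∀ {i j y y′} → Bridge k i x j y → Bridge k i x′ j y′ → uid k n x ≡ uid k n x′
      uid-unique (inj₁ (_ , ux , _)) (inj₁ (_ , ux′ , _)) = trans ux (sym ux′)
      uid-unique (inj₁ (i<j , _))    (inj₂ (j<i , _))     = ⊥-elim (<-asym i<j j<i)
      uid-unique (inj₂ (j<i , _))    (inj₁ (i<j , _))     = ⊥-elim (<-asym i<j j<i)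
      uid-unique (inj₂ (_ , _ , ux)) (inj₂ (_ , _ , ux′)) = trans ux (sym ux′)

  -- A vertex with uid u in copy i bridges to copy u if u < i and to copy u + 1 otherwise.
  bridge-target-unique : ∀ k {i j l x y z} → Bridge k i x j y → Bridge k i x l z → j ≡ l
  bridge-target-unique k b b′ = toℕ-injective (targets b b′)
    where
      below-above : ∀ {a b c} → a < b → b ∸ 1 ≡ c → ¬ c < a
      below-above {b = suc b} a<b refl c<a = <⇒≱ c<a (≤-pred a<b)
      targets : ∀ {i j l x y z} → Bridge k i x j y → Bridge k i x l z → toℕ j ≡ toℕ l
      targets (inj₁ (i<j , ux , _)) (inj₁ (i<l , ux′ , _)) =
        ∸-cancelʳ-≡ (≤-<-trans z≤n i<j) (≤-<-trans z≤n i<l) (trans (sym ux) ux′)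
      targets (inj₁ (i<j , ux , _)) (inj₂ (l<i , _ , ux′)) =
        ⊥-elim (below-above i<j (trans (sym ux) ux′) l<i)
      targets (inj₂ (j<i , _ , ux)) (inj₁ (i<l , ux′ , _)) =
        ⊥-elim (below-above i<l (trans (sym ux′) ux) j<i)
      targets (inj₂ (_ , _ , ux))   (inj₂ (_ , _ , ux′)) = trans (sym ux) ux′

  adjacent-bridges : ∀ k {i j x x′ y y′} → Adj k n x x′ → Bridge k i x j y → ¬ Bridge k i x′ j y′
  adjacent-bridges k xx′ b b′ = Adj-irrefl k (subst (Adj k n _) (sym (bridge-source-unique k b b′)) xx′)

  adj-between-copies : ∀ k {i j x y} → Adj (suc k) n (i , x) (j , y) → i ≢ j → Bridge k i x j y
  adj-between-copies k (inj₁ (i≡j , _)) i≢j = ⊥-elim (i≢j i≡j)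
  adj-between-copies k (inj₂ b)         _   = b

  adj-within-copy : ∀ k {i x y} → Adj (suc k) n (i , x) (i , y) → Adj k n x y
  adj-within-copy k (inj₁ (_ , xy)) = xy
  adj-within-copy k (inj₂ b)        = ⊥-elim (bridge-copies-distinct k b refl)

  triangle-within-copy : ∀ k {i j l x y z} → Adj (suc k) n (i , x) (j , y) →
    Adj (suc k) n (i , x) (l , z) → Adj (suc k) n (j , y) (l , z) → i ≡ j × i ≡ l
  triangle-within-copy k {i} {j} {l} xy xz yz with i ≟ j | i ≟ l
  ... | yes i≡j | yes i≡l = i≡j , i≡l
  ... | yes refl | no i≢l = ⊥-elim (adjacent-bridges k (adj-within-copy k xy)
                              (adj-between-copies k xz i≢l) (adj-between-copies k yz i≢l))
  ... | no i≢j | yes refl = ⊥-elim (adjacent-bridges k (adj-within-copy k xz)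
                              (adj-between-copies k xy i≢j) (swap (adj-between-copies k yz (≢-sym i≢j))))
  ... | no i≢j | no i≢l with j ≟ l
  ...   | yes refl = ⊥-elim (adjacent-bridges k (adj-within-copy k yz)
                       (swap (adj-between-copies k xy i≢j)) (swap (adj-between-copies k xz i≢l)))
  ...   | no j≢l = ⊥-elim (j≢l (bridge-target-unique k (adj-between-copies k xy i≢j) (adj-between-copies k xz i≢l)))

  commonNeighbour-within-copy : ∀ k {i x y} → Adj (suc k) n (i , x) (i , y) →
    D.CommonNeighbour (suc k) (i , x) (i , y) → D.CommonNeighbour k x y
  commonNeighbour-within-copy k xy ((l , z) , xz , yz) with triangle-within-copy k xy xz yz
  ... | _ , refl = z , adj-within-copy k xz , adj-within-copy k yz

  triangleEdge-within-copy : ∀ k {i j x y} → D.TriangleEdge (suc k) (i , x) (j , y) → i ≡ j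
  triangleEdge-within-copy k (xy , _ , xz , yz) = proj₁ (triangle-within-copy k xy xz yz)

  triangleEdge-lower : ∀ k {i x y} → D.TriangleEdge (suc k) (i , x) (i , y) → D.TriangleEdge k x y
  triangleEdge-lower k (xy , c) = adj-within-copy k xy , commonNeighbour-within-copy k xy c

  commonNeighbour-lift : ∀ k {i x y} → D.CommonNeighbour k x y → D.CommonNeighbour (suc k) (i , x) (i , y)
  commonNeighbour-lift k {i} (z , xz , yz) = (i , z) , inj₁ (refl , xz) , inj₁ (refl , yz)

  triangleEdge-lift : ∀ k {i x y} → D.TriangleEdge k x y → D.TriangleEdge (suc k) (i , x) (i , y)
  triangleEdge-lift k (xy , c) = inj₁ (refl , xy) , commonNeighbour-lift k c

  nonTriangleEdge-lift : ∀ k {i x y} → D.NonTriangleEdge k x y → D.NonTriangleEdge (suc k) (i , x) (i , y)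
  nonTriangleEdge-lift k (xy , ¬c) = inj₁ (refl , xy) , λ c → ¬c (commonNeighbour-within-copy k (inj₁ (refl , xy)) c)

  nonTriangleEdge-lower : ∀ k {i x y} → D.NonTriangleEdge (suc k) (i , x) (i , y) → D.NonTriangleEdge k x y
  nonTriangleEdge-lower k (xy , ¬c) = adj-within-copy k xy , λ c → ¬c (commonNeighbour-lift k c)

  bridge-nonTriangleEdge : ∀ k {i j x y} → Bridge k i x j y → D.NonTriangleEdge (suc k) (i , x) (j , y)
  bridge-nonTriangleEdge k b =
    inj₂ b , λ (_ , xz , yz) → bridge-copies-distinct k b (proj₁ (triangle-within-copy k (inj₂ b) xz yz))

  alternatingPath-lift : ∀ k {i w v} → D.AlternatingPath k w v → D.AlternatingPath (suc k) (i , w) (i , v)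
  alternatingPath-lift k {i} (w₂ , w₃ , w₄ , w₅ , t₁ , n₁ , t₂ , n₂ , t₃) =
    (i , w₂) , (i , w₃) , (i , w₄) , (i , w₅) ,
    triangleEdge-lift k t₁ , nonTriangleEdge-lift k n₁ , triangleEdge-lift k t₂ ,
    nonTriangleEdge-lift k n₂ , triangleEdge-lift k t₃

  -- Triangles live in the bottom copies of K_n, whose uids form a block of n consecutive numbers.
  triangleEdge-uid-close : ∀ k {x y} → D.TriangleEdge k x y → uid k n x < uid k n y + n
  triangleEdge-uid-close zero    {x} {y} _ = <-≤-trans (toℕ<n x) (m≤n+m n (toℕ y))
  triangleEdge-uid-close (suc k) {i , x} {j , y} e with triangleEdge-within-copy k e
  ... | refl = begin-strict
    toℕ i * t k n + uid k n x           <⟨ +-monoʳ-< (toℕ i * t k n) (triangleEdge-uid-close k (triangleEdge-lower k e)) ⟩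
    toℕ i * t k n + (uid k n y + n)     ≡⟨ +-assoc (toℕ i * t k n) (uid k n y) n ⟨
    toℕ i * t k n + uid k n y + n       ∎
    where open ≤-Reasoning

  bridge-off-hexagons : ∀ k {i j x y} → Bridge k i x j y → toℕ i + n ≤ toℕ j ∸ 1 →
                        ¬ D.AlternatingPath (suc k) (j , y) (i , x)
  bridge-off-hexagons k {i} {j} b far-apart ((i₂ , x₂) , (i₃ , x₃) , (i₄ , x₄) , (i₅ , x₅) , t₁ , n₁ , t₂ , n₂ , t₃)
    with triangleEdge-within-copy k t₁ | triangleEdge-within-copy k t₂ | triangleEdge-within-copy k t₃
  ... | refl | refl | refl with i₃ ≟ i | i₃ ≟ j
  ... | yes refl | _ = adjacent-bridges k (adj-within-copy k (proj₁ t₁)) (swap b)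
                         (adj-between-copies k (proj₁ n₁) (≢-sym (bridge-copies-distinct k b)))
  ... | no _ | yes refl = adjacent-bridges k (adj-within-copy k (proj₁ t₃))
                            (swap (adj-between-copies k (proj₁ n₂) (bridge-copies-distinct k (swap b)))) b
  ... | no i₃≢i | no i₃≢j = <-irrefl refl (begin-strict
    toℕ j ∸ 1      ≤⟨ bridge-uid-≥ k (swap (adj-between-copies k (proj₁ n₁) (≢-sym i₃≢j))) ⟩
    uid k n x₃     <⟨ triangleEdge-uid-close k (triangleEdge-lower k t₂) ⟩
    uid k n x₄ + n ≤⟨ +-monoˡ-≤ n (bridge-uid-≤ k (adj-between-copies k (proj₁ n₂) i₃≢i)) ⟩
    toℕ i + n      ≤⟨ far-apart ⟩
    toℕ j ∸ 1      ∎)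
    where open ≤-Reasoning

pattern 1F = sucF 0F
pattern 2F = sucF 1F

module DCell≥3 (m : ℕ) where

  private
    n : ℕ
    n = 3 + m

  open DCell n

  copy : ∀ k → Fin 3 → Fin (t k n + 1)
  copy k c = inject≤ c (≤-trans (m≤m+n 3 m) (≤-trans (n≤t k) (m≤m+n (t k n) 1)))

  toℕ-copy : ∀ k c → toℕ (copy k c) ≡ toℕ c
  toℕ-copy k c = toℕ-inject≤ c _

  cross-copies : ∀ k {a b x y} → toℕ a < toℕ b → uid k n x ≡ toℕ b ∸ 1 → uid k n y ≡ toℕ a →
                 Cross k n (copy k a) x (copy k b) y
  cross-copies k {a} {b} a<b ux uy rewrite toℕ-copy k a | toℕ-copy k b = a<b , ux , uy

  origin : ∀ k → Fin n → V k n
  origin zero    d = d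
  origin (suc k) d = copy k 0F , origin k d

  uid-origin : ∀ k d → uid k n (origin k d) ≡ toℕ d
  uid-origin zero    d = refl
  uid-origin (suc k) d = cong₂ _+_ (cong (_* t k n) (toℕ-copy k 0F)) (uid-origin k d)

  origin-adj : ∀ k {d e} → d ≢ e → Adj k n (origin k d) (origin k e)
  origin-adj zero    d≢e = d≢e
  origin-adj (suc k) d≢e = inj₁ (refl , origin-adj k d≢e)

  origin-triangleEdge : ∀ k {d e} f → d ≢ e → d ≢ f → e ≢ f → D.TriangleEdge k (origin k d) (origin k e)
  origin-triangleEdge k f d≢e d≢f e≢f =
    origin-adj k d≢e , origin k f , origin-adj k d≢f , origin-adj k e≢f

  bridge-from-origin : ∀ k {j y} → Bridge k (copy k 0F) (origin k 0F) j y → j ≡ copy k 1F × y ≡ origin k 0F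
  bridge-from-origin k {j} {y} (inj₁ (0<j , ux , uy)) = j≡1 , y≡origin
    where
      j≡1 : j ≡ copy k 1F
      j≡1 = toℕ-injective (trans (∸-cancelʳ-≡ (≤-<-trans z≤n 0<j) (s≤s z≤n) (trans (sym ux) (uid-origin k 0F)))
                                 (sym (toℕ-copy k 1F)))
      y≡origin : y ≡ origin k 0F
      y≡origin = uid-injective k (trans uy (trans (toℕ-copy k 0F) (sym (uid-origin k 0F))))
  bridge-from-origin k {j} (inj₂ (j<0 , _)) = ⊥-elim (n≮0 (subst (toℕ j <_) (toℕ-copy k 0F) j<0))

  -- Writing (copy , a₀) for the vertex whose remaining digits are 0, this is the path
  -- (1,0) ─ (1,1) ─ (2,1) ─ (2,0) ─ (0,1) ─ (0,0).
  origin-hexagon : ∀ k → D.AlternatingPath (suc k) (copy k 1F , origin k 0F) (copy k 0F , origin k 0F)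
  origin-hexagon k =
    (copy k 1F , origin k 1F) , (copy k 2F , origin k 1F) , (copy k 2F , origin k 0F) , (copy k 0F , origin k 1F) ,
    triangleEdge-lift k (origin-triangleEdge k 2F (λ ()) (λ ()) (λ ())) ,
    bridge-nonTriangleEdge k (inj₁ (cross-copies k (s≤s (s≤s z≤n)) (uid-origin k 1F) (uid-origin k 1F))) ,
    triangleEdge-lift k (origin-triangleEdge k 2F (λ ()) (λ ()) (λ ())) ,
    bridge-nonTriangleEdge k (inj₂ (cross-copies k (s≤s z≤n) (uid-origin k 1F) (uid-origin k 0F))) ,
    triangleEdge-lift k (origin-triangleEdge k 2F (λ ()) (λ ()) (λ ()))

  origin-edges-on-hexagons : ∀ k {w} → D.NonTriangleEdge k (origin k 0F) w → D.AlternatingPath k w (origin k 0F)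
  origin-edges-on-hexagons zero {w} (_ , ¬c) with w ≟ 1F
  ... | yes refl = ⊥-elim (¬c (2F , (λ ()) , (λ ())))
  ... | no w≢1 = ⊥-elim (¬c (1F , (λ ()) , w≢1))
  origin-edges-on-hexagons (suc k) {j , y} e with j ≟ copy k 0F
  ... | yes refl = alternatingPath-lift k (origin-edges-on-hexagons k (nonTriangleEdge-lower k e))
  ... | no j≢0 with bridge-from-origin k (adj-between-copies k (proj₁ e) (≢-sym j≢0))
  ...   | refl , refl = origin-hexagon k

  origin-lacks-nonHexagonalEdge : ∀ k → ¬ D.HasNonHexagonalEdge k (origin k 0F)
  origin-lacks-nonHexagonalEdge k (_ , e , ¬path) = ¬path (origin-edges-on-hexagons k e)

  module _ (k : ℕ) where

    private
      T : ℕ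
      T = t k n

    far-bound : T + 1 < t (suc k) n + 1
    far-bound = ≤-<-trans (m≤m*n (T + 1) T {{>-nonZero (≤-trans (s≤s z≤n) (n≤t k))}})
                          (m<m+n (t (suc k) n) (s≤s z≤n))

    far : Fin (t (suc k) n + 1)
    far = fromℕ< far-bound

    toℕ-far : toℕ far ≡ T + 1
    toℕ-far = toℕ-fromℕ< far-bound

    toℕ-far∸1 : toℕ far ∸ 1 ≡ T
    toℕ-far∸1 = trans (cong (_∸ 1) toℕ-far) (m+n∸n≡m T 1)

    copy1-origin : V (suc k) n
    copy1-origin = copy k 1F , origin k 0F

    uid-copy1-origin : uid (suc k) n copy1-origin ≡ T
    uid-copy1-origin = begin
      toℕ (copy k 1F) * T + uid k n (origin k 0F)   ≡⟨ cong₂ _+_ (cong (_* T) (toℕ-copy k 1F)) (uid-origin k 0F) ⟩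
      1 * T + 0                                      ≡⟨ +-identityʳ (1 * T) ⟩
      1 * T                                          ≡⟨ *-identityˡ T ⟩
      T                                              ∎
      where open ≡-Reasoning

    far-apart : toℕ (copy (suc k) 0F) + n ≤ toℕ far ∸ 1
    far-apart = begin
      toℕ (copy (suc k) 0F) + n   ≡⟨ cong (_+ n) (toℕ-copy (suc k) 0F) ⟩
      n                           ≤⟨ n≤t k ⟩
      T                           ≡⟨ toℕ-far∸1 ⟨
      toℕ far ∸ 1                 ∎
      where open ≤-Reasoning

    witness : V (suc (suc k)) n
    witness = copy (suc k) 0F , copy1-origin

    witness-bridge : Bridge (suc k) (copy (suc k) 0F) copy1-origin far (origin (suc k) 0F)
    witness-bridge = inj₁ (subst₂ _<_ (sym (toℕ-copy (suc k) 0F)) (sym toℕ-far) (m≤n+m 1 T) ,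
                           trans uid-copy1-origin (sym toℕ-far∸1) ,
                           trans (uid-origin (suc k) 0F) (sym (toℕ-copy (suc k) 0F)))

    witness-has-nonHexagonalEdge : D.HasNonHexagonalEdge (suc (suc k)) witness
    witness-has-nonHexagonalEdge =
      (far , origin (suc k) 0F) , bridge-nonTriangleEdge (suc k) witness-bridge ,
      bridge-off-hexagons (suc k) witness-bridge far-apart

lemma6 : (k n : ℕ) → 2 ≤ k → 3 ≤ n → ¬ VertexTransitive (V k n) (Adj k n)
lemma6 (suc (suc k)) (suc (suc (suc m))) _ _ =
  separated⇒¬vertexTransitive (D.HasNonHexagonalEdge (2 + k)) (D.HasNonHexagonalEdge-invariant (2 + k))
    (witness-has-nonHexagonalEdge k) (origin-lacks-nonHexagonalEdge (2 + k))
  where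
    open DCell (3 + m)
    open DCell≥3 m
lemma6 zero          _                   ()                _
lemma6 (suc zero)    _                   (s≤s ())          _
lemma6 (suc (suc k)) zero                _                 ()
lemma6 (suc (suc k)) (suc zero)          _                 (s≤s ())
lemma6 (suc (suc k)) (suc (suc zero))    _                 (s≤s (s≤s ()))
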